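{- For every positive integer $b$ there exists a polynomial $u(z)$ such that in any $b$-simple $n$-uniform hypergraph with maximum vertex degree $d$, any vertex belongs to at most $d^{k-1}\,n^{k+b}\,u(k)$ chains of length $k\ge 3$ that are not $b$-disjoint.
   Context: A hypergraph has a finite vertex set and a family of subsets called edges; it is $n$-uniform if every edge has $n$ elements and $b$-simple if any two distinct edges share at most $b$ vertices. A chain of length $k$ is a sequence of edges $(s_1,\ldots,s_k)$ with $|s_i\cap s_{i+1}|=1$ for $i\in[k-1]$ and the sets $s_i\cap s_{i+1}$ pairwise disjoint. A permutation $\pi$ of $[k]$ is connected if for every $i\in[k]$ the set $\{\pi(1),\ldots,\pi(i)\}$ consists of $i$ consecutive integers. A chain $(s_1,\ldots,s_k)$ is $b$-disjoint if there is a connected permutation $\pi$ of $[k]$ such that for every $i=2,\ldots,k$ the edge $s_{\pi(i)}$ contains at least $n-b$ vertices not contained in $s_{\pi(1)}\cup\cdots\cup s_{\pi(i-1)}$. A vertex belongs to a chain if it lies in one of its edges; chains are counted as sequences. -}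

module Defs where

open import Data.Nat using (ℕ; zero; suc; _+_; _*_; _∸_; _^_; _≤_; _<_; _<?_)
open import Data.Fin using (Fin; toℕ)
open import Data.Fin.Subset using (Subset; _∈_; _∉_; _∩_; _─_; ⋃; ∣_∣; Empty)
open import Data.Fin.Subset.Properties using (_∈?_)
open import Data.Fin.Permutation using (Permutation′; _⟨$⟩ʳ_)
open import Data.List using (List; []; _∷_; length; filter; map; allFin)
open import Data.Product using (Σ; ∃; _×_; _,_)
open import Function.Bundles using (_⇔_)
open import Function.Definitions using (Injective)
open import Relation.Binary.PropositionalEquality using (_≡_; _≢_)
open import Relation.Nullary using (¬_)

-- A hypergraph on vertex set Fin V with m edges, given as an injective
-- family (so the edges form a set of subsets) E : Fin m → Subset V.

degree : ∀ {V m} → (Fin m → Subset V) → Fin V → ℕ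
degree {V} {m} E v = length (filter (λ i → v ∈? E i) (allFin m))

IsEdgeFamily : ∀ {V m} → (Fin m → Subset V) → Set
IsEdgeFamily E = Injective _≡_ _≡_ E

Uniform : ∀ {V m} → ℕ → (Fin m → Subset V) → Set
Uniform {m = m} n E = (i : Fin m) → ∣ E i ∣ ≡ n

Simple : ∀ {V m} → ℕ → (Fin m → Subset V) → Set
Simple {m = m} b E = (i j : Fin m) → i ≢ j → ∣ E i ∩ E j ∣ ≤ b

MaxDegree : ∀ {V m} → ℕ → (Fin m → Subset V) → Set
MaxDegree {V} d E = ((v : Fin V) → degree E v ≤ d) × (∃ λ v → degree E v ≡ d)

Consec : ∀ {k} → Fin k → Fin k → Set
Consec i j = toℕ j ≡ suc (toℕ i)

IsChain : ∀ {V k} → (Fin k → Subset V) → Set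
IsChain {k = k} s =
  ((i j : Fin k) → Consec i j → ∣ s i ∩ s j ∣ ≡ 1) ×
  ((i i′ j j′ : Fin k) → Consec i i′ → Consec j j′ → i ≢ j →
     Empty ((s i ∩ s i′) ∩ (s j ∩ s j′)))

Connected : ∀ {k} → Permutation′ k → Set
Connected {k} π = (i : Fin k) → ∃ λ a → (x : Fin k) →
  (∃ λ j → toℕ j ≤ toℕ i × π ⟨$⟩ʳ j ≡ x) ⇔ (a ≤ toℕ x × toℕ x < a + suc (toℕ i))

prefixUnion : ∀ {V k} → (Fin k → Subset V) → Permutation′ k → Fin k → Subset V
prefixUnion {k = k} s π i =
  ⋃ (map (λ j → s (π ⟨$⟩ʳ j)) (filter (λ j → toℕ j <? toℕ i) (allFin k)))

BDisjoint : ∀ {V k} → ℕ → ℕ → (Fin k → Subset V) → Set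
BDisjoint {k = k} n b s = ∃ λ (π : Permutation′ k) → Connected π ×
  ((i : Fin k) → 1 ≤ toℕ i →
     n ∸ b ≤ ∣ s (π ⟨$⟩ʳ i) ─ prefixUnion s π i ∣)

BelongsTo : ∀ {V k} → Fin V → (Fin k → Subset V) → Set
BelongsTo v s = ∃ λ i → v ∈ s i

-- polynomials with natural-number coefficients (constant term first)
evalPoly : List ℕ → ℕ → ℕ
evalPoly [] z = 0
evalPoly (c ∷ cs) z = c + z * evalPoly cs z

-- Order the edges of a non-b-disjoint chain through v, with v in its j-th edge, as
-- j, j - 1, …, 0, j + 1, …, k - 1; this is a connected permutation.  Every edge after
-- the first meets an earlier chain neighbour, and since the chain is not b-disjoint some
-- edge (the stale one) has more than b vertices in earlier edges.  So the chain is
-- recovered edge by edge, in this order, from: j and the stale step; the index of the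
-- first edge among the at most d edges at v; for every other non-stale edge, the position
-- of a common vertex in its already known neighbour and the index of the edge among the
-- at most d edges at that vertex; and for the stale edge, b + 1 of its vertices, each given
-- by an earlier edge and a position in it, which pin it down by b-simplicity.  Hence there
-- are at most k (k - 1) d (n d)^(k-2) (k n)^(b+1) ≤ d^(k-1) n^(k+b) k^(b+3) such chains.

module Submission where

open import Defs
open import Data.Nat using (ℕ; zero; suc; _+_; _*_; _∸_; _^_; _≤_; _<_; z≤n; s≤s; s≤s⁻¹; _≤?_; _≟_)
open import Data.Nat.Properties
open import Data.Nat.Solver using (module +-*-Solver)
open import Data.Fin as Fin using (Fin; zero; suc; toℕ; fromℕ<; inject₁; inject≤; cast; combine; funToFin; finToFun; punchIn; punchOut)
open import Data.Fin.Properties as Finₚ using (toℕ-injective; toℕ-fromℕ<; toℕ<n; toℕ-inject₁; toℕ-cast; inject≤-injective; injective⇒≤; combine-injective; finToFun-funToFin; punchIn-punchOut; ¬∀⟶∃¬)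
open import Data.Fin.Induction using (<-wellFounded)
open import Data.Fin.Permutation using (Permutation′; permutation; _⟨$⟩ʳ_)
open import Data.Fin.Subset using (Subset; Nonempty; inside; outside; _∈_; _∩_; _─_; ⋃; ∣_∣)
open import Data.Fin.Subset.Properties using (x∈p∩q⁺; x∈p∩q⁻; x∈p∪q⁻; ∉⊥; _∈?_)
open import Data.Vec using (Vec; []; _∷_; lookup; tabulate; here; there)
open import Data.Vec.Properties using (tabulate∘lookup; tabulate-cong)
open import Data.List as List using (List; []; _∷_; length; allFin)
open import Data.List.Membership.Propositional using () renaming (_∈_ to _∈ₗ_)
open import Data.List.Membership.Propositional.Properties using (∈-map⁻; ∈-filter⁺; ∈-filter⁻; ∈-allFin; ∈-lookup)
open import Data.List.Membership.Setoid.Properties using (index-injective)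
open import Data.List.Relation.Unary.Any using (here; there; index)
open import Data.List.Relation.Unary.All as All using (All)
open import Data.List.Relation.Unary.Unique.Propositional using (Unique; _∷_)
open import Data.Product using (Σ; ∃; _×_; _,_; proj₁; proj₂; swap)
open import Data.Sum as Sum using (_⊎_; inj₁; inj₂)
open import Function using (_∘_; const; mk⇔)
open import Function.Definitions using (Injective)
import Induction.WellFounded as WF
open import Relation.Binary.Definitions using (tri<; tri≈; tri>)
open import Relation.Binary.PropositionalEquality
open import Relation.Nullary using (¬_; Dec; yes; no; contradiction)
open import Relation.Nullary.Decidable using (_→-dec_)

Unique⇒lookup-injective : ∀ {A : Set} {xs : List A} → Unique xs → Injective _≡_ _≡_ (List.lookup xs)
Unique⇒lookup-injective {xs = _ ∷ _} (_ ∷ _) {zero} {zero} _ = refl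
Unique⇒lookup-injective {xs = _ ∷ _} (x∉ ∷ _) {zero} {suc j} eq = contradiction eq (All.lookup x∉ (∈-lookup j))
Unique⇒lookup-injective {xs = _ ∷ _} (x∉ ∷ _) {suc i} {zero} eq = contradiction (sym eq) (All.lookup x∉ (∈-lookup i))
Unique⇒lookup-injective {xs = _ ∷ _} (_ ∷ u) {suc i} {suc j} eq = cong suc (Unique⇒lookup-injective u eq)

length≤-of-injective-code : ∀ {A : Set} {P : A → Set} {N} (code : ∀ {a} → P a → Fin N) →
  (∀ {a a′} (p : P a) (p′ : P a′) → code p ≡ code p′ → a ≡ a′) →
  ∀ {xs} → Unique xs → All P xs → length xs ≤ N
length≤-of-injective-code code code-injective {xs} unique ps =
  injective⇒≤ {f = λ i → code (All.lookup ps (∈-lookup i))}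
    (Unique⇒lookup-injective unique ∘ code-injective _ _)

funToFin-injective : ∀ {a b} {f g : Fin a → Fin b} → funToFin f ≡ funToFin g → ∀ x → f x ≡ g x
funToFin-injective {f = f} {g} eq x =
  trans (sym (finToFun-funToFin f x)) (trans (cong (λ i → finToFun i x) eq) (finToFun-funToFin g x))

indexIn : ∀ {V} {p : Subset V} {x} → x ∈ p → Fin ∣ p ∣
indexIn {p = inside ∷ _} here = zero
indexIn {p = inside ∷ _} (there x∈p) = suc (indexIn x∈p)
indexIn {p = outside ∷ _} (there x∈p) = indexIn x∈p

indexIn-injective : ∀ {V} {p : Subset V} {x y} (x∈p : x ∈ p) (y∈p : y ∈ p) →
  indexIn x∈p ≡ indexIn y∈p → x ≡ y
indexIn-injective {p = inside ∷ _} here here _ = refl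
indexIn-injective {p = inside ∷ _} (there x∈p) (there y∈p) eq =
  cong suc (indexIn-injective x∈p y∈p (Finₚ.suc-injective eq))
indexIn-injective {p = outside ∷ _} (there x∈p) (there y∈p) eq =
  cong suc (indexIn-injective x∈p y∈p eq)

injective⇒≤∣p∣ : ∀ {V k} {p : Subset V} (f : Fin k → Fin V) → Injective _≡_ _≡_ f →
  (∀ r → f r ∈ p) → k ≤ ∣ p ∣
injective⇒≤∣p∣ f f-injective f∈p =
  injective⇒≤ {f = indexIn ∘ f∈p} (f-injective ∘ indexIn-injective (f∈p _) (f∈p _))

≤∣p∣⇒injective : ∀ {V k} (p : Subset V) → k ≤ ∣ p ∣ →
  Σ (Fin k → Fin V) λ f → Injective _≡_ _≡_ f × (∀ r → f r ∈ p)
≤∣p∣⇒injective {k = zero} _ _ = (λ ()) , (λ { {()} }) , (λ ())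
≤∣p∣⇒injective {k = suc k} (inside ∷ p) (s≤s k≤∣p∣) with ≤∣p∣⇒injective p k≤∣p∣
... | f , f-injective , f∈p = g , g-injective , g∈
  where
  g : Fin (suc k) → Fin _
  g zero = zero
  g (suc r) = suc (f r)
  g-injective : Injective _≡_ _≡_ g
  g-injective {zero} {zero} _ = refl
  g-injective {suc r} {suc r′} eq = cong suc (f-injective (Finₚ.suc-injective eq))
  g∈ : ∀ r → g r ∈ inside ∷ p
  g∈ zero = here
  g∈ (suc r) = there (f∈p r)
≤∣p∣⇒injective {k = suc k} (outside ∷ p) k≤∣p∣ with ≤∣p∣⇒injective p k≤∣p∣
... | f , f-injective , f∈p = suc ∘ f , f-injective ∘ Finₚ.suc-injective , there ∘ f∈p

∣p∣≡∣p∩q∣+∣p─q∣ : ∀ {V} (p q : Subset V) → ∣ p ∣ ≡ ∣ p ∩ q ∣ + ∣ p ─ q ∣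
∣p∣≡∣p∩q∣+∣p─q∣ [] [] = refl
∣p∣≡∣p∩q∣+∣p─q∣ (inside ∷ p) (inside ∷ q) = cong suc (∣p∣≡∣p∩q∣+∣p─q∣ p q)
∣p∣≡∣p∩q∣+∣p─q∣ (inside ∷ p) (outside ∷ q) = trans (cong suc (∣p∣≡∣p∩q∣+∣p─q∣ p q)) (sym (+-suc _ _))
∣p∣≡∣p∩q∣+∣p─q∣ (outside ∷ p) (inside ∷ q) = ∣p∣≡∣p∩q∣+∣p─q∣ p q
∣p∣≡∣p∩q∣+∣p─q∣ (outside ∷ p) (outside ∷ q) = ∣p∣≡∣p∩q∣+∣p─q∣ p q

∣p─q∣<n∸b⇒b<∣p∩q∣ : ∀ {V n b} (p q : Subset V) → ∣ p ∣ ≡ n → ∣ p ─ q ∣ < n ∸ b → b < ∣ p ∩ q ∣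
∣p─q∣<n∸b⇒b<∣p∩q∣ {n = n} {b} p q ∣p∣≡n fresh<n∸b = +-cancelʳ-< (∣ p ─ q ∣) b (∣ p ∩ q ∣) (begin-strict
  b + ∣ p ─ q ∣  ≡⟨ +-comm b _ ⟩
  ∣ p ─ q ∣ + b  <⟨ +-monoˡ-< b fresh<n∸b ⟩
  n ∸ b + b      ≡⟨ m∸n+n≡m b≤n ⟩
  n              ≡⟨ trans (sym ∣p∣≡n) (∣p∣≡∣p∩q∣+∣p─q∣ p q) ⟩
  ∣ p ∩ q ∣ + ∣ p ─ q ∣ ∎)
  where
  open ≤-Reasoning
  b≤n : b ≤ n
  b≤n = ≮⇒≥ λ n<b → n≮0 (subst (∣ p ─ q ∣ <_) (m≤n⇒m∸n≡0 (<⇒≤ n<b)) fresh<n∸b)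

x∈⋃⁻ : ∀ {V} (ps : List (Subset V)) {x} → x ∈ ⋃ ps → ∃ λ p → p ∈ₗ ps × x ∈ p
x∈⋃⁻ [] x∈⊥ = contradiction x∈⊥ ∉⊥
x∈⋃⁻ (p ∷ ps) x∈p∪⋃ps with x∈p∪q⁻ p (⋃ ps) x∈p∪⋃ps
... | inj₁ x∈p = p , here refl , x∈p
... | inj₂ x∈⋃ps with x∈⋃⁻ ps x∈⋃ps
...   | p′ , p′∈ps , x∈p′ = p′ , there p′∈ps , x∈p′

∈-prefixUnion⁻ : ∀ {V k} (s : Fin k → Subset V) (π : Permutation′ k) i {x} →
  x ∈ prefixUnion s π i → ∃ λ j → j Fin.< i × x ∈ s (π ⟨$⟩ʳ j)
∈-prefixUnion⁻ {k = k} s π i x∈ with x∈⋃⁻ _ x∈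
... | p , p∈ , x∈p with ∈-map⁻ (λ j → s (π ⟨$⟩ʳ j)) p∈
...   | j , j∈ , refl = j , proj₂ (∈-filter⁻ (λ j → toℕ j <? toℕ i) {xs = allFin k} j∈) , x∈p

1≤∣p∣⇒Nonempty : ∀ {V} {p : Subset V} → 1 ≤ ∣ p ∣ → Nonempty p
1≤∣p∣⇒Nonempty {p = p} 1≤∣p∣ with ≤∣p∣⇒injective p 1≤∣p∣
... | f , _ , f∈p = f zero , f∈p zero

Adjacent : ∀ {K} → Fin K → Fin K → Set
Adjacent i i′ = Consec i i′ ⊎ Consec i′ i

adjacent-edges-meet : ∀ {V K} {s : Fin K → Subset V} → IsChain s →
  ∀ {i i′} → Adjacent i i′ → ∃ λ w → w ∈ s i × w ∈ s i′
adjacent-edges-meet {s = s} (meet , _) {i} {i′} (inj₁ i~i′)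
  with 1≤∣p∣⇒Nonempty (≤-reflexive (sym (meet i i′ i~i′)))
... | w , w∈ = w , x∈p∩q⁻ (s i) (s i′) w∈
adjacent-edges-meet {s = s} (meet , _) {i} {i′} (inj₂ i′~i)
  with 1≤∣p∣⇒Nonempty (≤-reflexive (sym (meet i′ i i′~i)))
... | w , w∈ = w , swap (x∈p∩q⁻ (s i′) (s i) w∈)

¬BDisjoint⇒stale-step : ∀ {V k n b} (s : Fin (suc k) → Subset V) (π : Permutation′ (suc k)) →
  Connected π → ¬ BDisjoint n b s →
  ∃ λ t → ∣ s (π ⟨$⟩ʳ suc t) ─ prefixUnion s π (suc t) ∣ < n ∸ b
¬BDisjoint⇒stale-step {k = k} {n} {b} s π connected ¬disjoint
  with ¬∀⟶∃¬ (suc k) Fresh Fresh? (λ fresh → ¬disjoint (π , connected , fresh))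
  where
  Fresh : Fin (suc k) → Set
  Fresh i = 1 ≤ toℕ i → n ∸ b ≤ ∣ s (π ⟨$⟩ʳ i) ─ prefixUnion s π i ∣
  Fresh? : ∀ i → Dec (Fresh i)
  Fresh? i = (1 ≤? toℕ i) →-dec (n ∸ b ≤? _)
... | zero , ¬fresh = contradiction (λ ()) ¬fresh
... | suc t , ¬fresh = t , ≰⇒> (¬fresh ∘ const)

-- The connected ordering j, j - 1, …, 0, j + 1, j + 2, …

reflectℕ : ℕ → ℕ → ℕ
reflectℕ j s with s ≤? j
... | yes _ = j ∸ s
... | no  _ = s

reflectℕ-≤ : ∀ {j s} → s ≤ j → reflectℕ j s ≡ j ∸ s
reflectℕ-≤ {j} {s} s≤j with s ≤? j
... | yes _ = refl
... | no s≰j = contradiction s≤j s≰j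

reflectℕ-> : ∀ {j s} → j < s → reflectℕ j s ≡ s
reflectℕ-> {j} {s} j<s with s ≤? j
... | yes s≤j = contradiction s≤j (<⇒≱ j<s)
... | no  _ = refl

reflectℕ-involutive : ∀ j s → reflectℕ j (reflectℕ j s) ≡ s
reflectℕ-involutive j s with ≤-<-connex s j
... | inj₁ s≤j = begin
  reflectℕ j (reflectℕ j s) ≡⟨ cong (reflectℕ j) (reflectℕ-≤ s≤j) ⟩
  reflectℕ j (j ∸ s)        ≡⟨ reflectℕ-≤ (m∸n≤m j s) ⟩
  j ∸ (j ∸ s)               ≡⟨ m∸[m∸n]≡n s≤j ⟩
  s                         ∎
  where open ≡-Reasoning
... | inj₂ j<s = trans (cong (reflectℕ j) (reflectℕ-> j<s)) (reflectℕ-> j<s)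

reflectℕ-< : ∀ {j s K} → j < K → s < K → reflectℕ j s < K
reflectℕ-< {j} {s} j<K s<K with ≤-<-connex s j
... | inj₁ s≤j = subst (_< _) (sym (reflectℕ-≤ s≤j)) (≤-<-trans (m∸n≤m j s) j<K)
... | inj₂ j<s = subst (_< _) (sym (reflectℕ-> j<s)) s<K

reflectℕ-window⁺ : ∀ {j i s} → s ≤ i → j ∸ i ≤ reflectℕ j s × reflectℕ j s < j ∸ i + suc i
reflectℕ-window⁺ {j} {i} {s} s≤i with ≤-<-connex s j
... | inj₁ s≤j rewrite reflectℕ-≤ s≤j =
  ∸-monoʳ-≤ j s≤i ,
  ≤-<-trans (m∸n≤m j s) (≤-trans (s≤s (m≤n+m∸n j i)) (≤-reflexive (+-comm (suc i) (j ∸ i))))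
... | inj₂ j<s rewrite reflectℕ-> j<s =
  ≤-trans (m∸n≤m j i) (<⇒≤ j<s) , ≤-trans (s≤s s≤i) (m≤n+m (suc i) (j ∸ i))

reflectℕ-window⁻ : ∀ {j i s} → j ∸ i ≤ reflectℕ j s → reflectℕ j s < j ∸ i + suc i → s ≤ i
reflectℕ-window⁻ {j} {i} {s} lo hi with ≤-<-connex s j
... | inj₁ s≤j rewrite reflectℕ-≤ s≤j = ≮⇒≥ λ i<s → <⇒≱ (∸-monoʳ-< i<s s≤j) lo
... | inj₂ j<s rewrite reflectℕ-> j<s with ≤-<-connex i j
...   | inj₁ i≤j = contradiction (s≤s⁻¹ (subst (s <_) top≡ hi)) (<⇒≱ j<s)
  where
  top≡ : j ∸ i + suc i ≡ suc j
  top≡ = trans (+-suc (j ∸ i) i) (cong suc (m∸n+n≡m i≤j))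
...   | inj₂ j<i = s≤s⁻¹ (subst (λ a → s < a + suc i) (m≤n⇒m∸n≡0 (<⇒≤ j<i)) hi)

reflectℕ-pivot : ∀ j → reflectℕ j (suc j) ≡ suc (reflectℕ j 0)
reflectℕ-pivot j = trans (reflectℕ-> (n<1+n j)) (cong suc (sym (reflectℕ-≤ z≤n)))

reflectℕ-suc : ∀ {j s} → s ≢ j →
  reflectℕ j (suc s) ≡ suc (reflectℕ j s) ⊎ reflectℕ j s ≡ suc (reflectℕ j (suc s))
reflectℕ-suc {j} {s} s≢j with <-cmp s j
... | tri< s<j _ _ = inj₂ (begin
  reflectℕ j s               ≡⟨ reflectℕ-≤ (<⇒≤ s<j) ⟩
  j ∸ s                      ≡⟨ +-∸-assoc 1 s<j ⟩
  suc (j ∸ suc s)            ≡⟨ cong suc (sym (reflectℕ-≤ s<j)) ⟩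
  suc (reflectℕ j (suc s))   ∎)
  where open ≡-Reasoning
... | tri≈ _ s≡j _ = contradiction s≡j s≢j
... | tri> _ _ j<s = inj₁ (trans (reflectℕ-> (m<n⇒m<1+n j<s)) (cong suc (sym (reflectℕ-> j<s))))

reflect : ∀ {K} → Fin K → Fin K → Fin K
reflect j s = fromℕ< (reflectℕ-< (toℕ<n j) (toℕ<n s))

toℕ-reflect : ∀ {K} (j s : Fin K) → toℕ (reflect j s) ≡ reflectℕ (toℕ j) (toℕ s)
toℕ-reflect j s = toℕ-fromℕ< _

reflect-involutive : ∀ {K} (j s : Fin K) → reflect j (reflect j s) ≡ s
reflect-involutive j s = toℕ-injective (begin
  toℕ (reflect j (reflect j s))           ≡⟨ toℕ-reflect j (reflect j s) ⟩
  reflectℕ (toℕ j) (toℕ (reflect j s))    ≡⟨ cong (reflectℕ (toℕ j)) (toℕ-reflect j s) ⟩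
  reflectℕ (toℕ j) (reflectℕ (toℕ j) (toℕ s)) ≡⟨ reflectℕ-involutive (toℕ j) (toℕ s) ⟩
  toℕ s                                   ∎)
  where open ≡-Reasoning

reflect-zero : ∀ {k} (j : Fin (suc k)) → reflect j zero ≡ j
reflect-zero j = toℕ-injective (trans (toℕ-reflect j zero) (reflectℕ-≤ z≤n))

reflectPerm : ∀ {K} → Fin K → Permutation′ K
reflectPerm j = permutation (reflect j) (reflect j) (reflect-involutive j) (reflect-involutive j)

-- The first i + 1 steps fill the window starting at j ∸ i (which is 0 once i ≥ j).
reflectPerm-connected : ∀ {K} (j : Fin K) → Connected (reflectPerm j)
reflectPerm-connected j i = toℕ j ∸ toℕ i , λ x → mk⇔ (to x) (from x)
  where
  Window : ℕ → Set
  Window y = toℕ j ∸ toℕ i ≤ y × y < toℕ j ∸ toℕ i + suc (toℕ i)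
  to : ∀ x → (∃ λ s → toℕ s ≤ toℕ i × reflect j s ≡ x) → Window (toℕ x)
  to _ (s , s≤i , refl) rewrite toℕ-reflect j s = reflectℕ-window⁺ s≤i
  from : ∀ x → Window (toℕ x) → ∃ λ s → toℕ s ≤ toℕ i × reflect j s ≡ x
  from x (lo , hi) =
    reflect j x , reflectℕ-window⁻ (subst (_ ≤_) (sym x≡) lo) (subst (_< _) (sym x≡) hi) , reflect-involutive j x
    where
    x≡ : reflectℕ (toℕ j) (toℕ (reflect j x)) ≡ toℕ x
    x≡ = trans (cong (reflectℕ (toℕ j)) (toℕ-reflect j x)) (reflectℕ-involutive (toℕ j) (toℕ x))

parent : ∀ {k} → Fin (suc k) → Fin k → Fin (suc k)
parent j s with toℕ s ≟ toℕ j
... | yes _ = zero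
... | no  _ = inject₁ s

parent< : ∀ {k} (j : Fin (suc k)) s → parent j s Fin.< suc s
parent< j s with toℕ s ≟ toℕ j
... | yes _ = s≤s z≤n
... | no  _ = s≤s (≤-reflexive (toℕ-inject₁ s))

reflect-parent-adjacent : ∀ {k} (j : Fin (suc k)) s → Adjacent (reflect j (parent j s)) (reflect j (suc s))
reflect-parent-adjacent j s with toℕ s ≟ toℕ j
... | yes s≡j = inj₁ (begin
  toℕ (reflect j (suc s))          ≡⟨ toℕ-reflect j (suc s) ⟩
  reflectℕ (toℕ j) (suc (toℕ s))   ≡⟨ cong (reflectℕ (toℕ j) ∘ suc) s≡j ⟩
  reflectℕ (toℕ j) (suc (toℕ j))   ≡⟨ reflectℕ-pivot (toℕ j) ⟩
  suc (reflectℕ (toℕ j) 0)         ≡⟨ cong suc (sym (toℕ-reflect j zero)) ⟩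
  suc (toℕ (reflect j zero))       ∎)
  where open ≡-Reasoning
... | no s≢j = Sum.map (λ e → trans at-suc (trans e (cong suc (sym at-s))))
                       (λ e → trans at-s (trans e (cong suc (sym at-suc))))
                       (reflectℕ-suc s≢j)
  where
  at-s : toℕ (reflect j (inject₁ s)) ≡ reflectℕ (toℕ j) (toℕ s)
  at-s = trans (toℕ-reflect j (inject₁ s)) (cong (reflectℕ (toℕ j)) (toℕ-inject₁ s))
  at-suc : toℕ (reflect j (suc s)) ≡ reflectℕ (toℕ j) (suc (toℕ s))
  at-suc = toℕ-reflect j (suc s)

module _ {V m} (E : Fin m → Subset V) where

  module _ {d} (degree≤ : ∀ w → degree E w ≤ d) where

    edgeIndex : ∀ {w e} → w ∈ E e → Fin d
    edgeIndex {w} {e} w∈e = inject≤ (index (∈-filter⁺ (λ i → w ∈? E i) (∈-allFin e) w∈e)) (degree≤ w)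

    edgeIndex-injective : ∀ {w w′ e e′} → w ≡ w′ → (w∈e : w ∈ E e) (w′∈e′ : w′ ∈ E e′) →
      edgeIndex w∈e ≡ edgeIndex w′∈e′ → e ≡ e′
    edgeIndex-injective refl w∈e w∈e′ eq =
      index-injective (setoid _) _ _ (inject≤-injective _ _ _ _ eq)

  module _ {n} (uniform : Uniform n E) where

    position : ∀ {z e} → z ∈ E e → Fin n
    position {e = e} z∈e = cast (uniform e) (indexIn z∈e)

    position-injective : ∀ {z z′ e e′} → e ≡ e′ → (z∈e : z ∈ E e) (z′∈e′ : z′ ∈ E e′) →
      position z∈e ≡ position z′∈e′ → z ≡ z′
    position-injective refl z∈e z′∈e eq = indexIn-injective z∈e z′∈e (toℕ-injective (begin
      toℕ (indexIn z∈e)    ≡⟨ toℕ-cast _ _ ⟨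
      toℕ (position z∈e)   ≡⟨ cong toℕ eq ⟩
      toℕ (position z′∈e)  ≡⟨ toℕ-cast _ _ ⟩
      toℕ (indexIn z′∈e)   ∎))
      where open ≡-Reasoning

  shared-vertices⇒same-edge : ∀ {b} → Simple b E → ∀ {a a′} (f : Fin (suc b) → Fin V) →
    Injective _≡_ _≡_ f → (∀ r → f r ∈ E a) → (∀ r → f r ∈ E a′) → a ≡ a′
  shared-vertices⇒same-edge simple {a} {a′} f f-injective f∈a f∈a′ with a Fin.≟ a′
  ... | yes a≡a′ = a≡a′
  ... | no  a≢a′ = contradiction (simple a a′ a≢a′)
                     (<⇒≱ (injective⇒≤∣p∣ f f-injective (λ r → x∈p∩q⁺ (f∈a r , f∈a′ r))))

-- Encoding non-disjoint chains through a fixed vertex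

module NonDisjointChains
  {V m n d b} (E : Fin m → Subset V) (uniform : Uniform n E) (simple : Simple b E)
  (degree≤ : ∀ w → degree E w ≤ d) (v : Fin V) (k : ℕ) where

  K : ℕ
  K = suc (suc k)

  edges : Vec (Fin m) K → Fin K → Subset V
  edges c i = E (lookup c i)

  NonDisjointThrough-v : Vec (Fin m) K → Set
  NonDisjointThrough-v c = IsChain (edges c) × BelongsTo v (edges c) × ¬ BDisjoint n b (edges c)

  visit : Vec (Fin m) K → Fin K → Fin K → Fin m
  visit c j i = lookup c (reflect j i)

  record Certificate (c : Vec (Fin m) K) (j : Fin K) (t : Fin (suc k)) : Set where
    field
      v∈start       : v ∈ E (visit c j zero)
      link          : Fin (suc k) → Fin V
      link∈visit    : ∀ s → link s ∈ E (visit c j (suc s))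
      link∈parent   : ∀ s → link s ∈ E (visit c j (parent j s))
      shared        : Fin (suc b) → Fin V
      shared-injective : Injective _≡_ _≡_ shared
      shared∈stale  : ∀ r → shared r ∈ E (visit c j (suc t))
      source        : Fin (suc b) → Fin K
      source<stale  : ∀ r → source r Fin.< suc t
      shared∈source : ∀ r → shared r ∈ E (visit c j (source r))

  Certified : Vec (Fin m) K → Set
  Certified c = Σ (Fin K) λ j → Σ (Fin (suc k)) (Certificate c j)

  certify : ∀ {c} → NonDisjointThrough-v c → Certified c
  certify {c} (chain , (j , v∈j) , ¬disjoint)
    with ¬BDisjoint⇒stale-step {n = n} {b} (edges c) (reflectPerm j) (reflectPerm-connected j) ¬disjoint
  ... | t , stale = j , t , record
    { v∈start          = subst (λ i → v ∈ edges c i) (sym (reflect-zero j)) v∈j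
    ; link             = λ s → proj₁ (links s)
    ; link∈visit       = λ s → proj₂ (proj₂ (links s))
    ; link∈parent      = λ s → proj₁ (proj₂ (links s))
    ; shared           = proj₁ sharing
    ; shared-injective = proj₁ (proj₂ sharing)
    ; shared∈stale     = λ r → proj₁ (shared∈ r)
    ; source           = λ r → proj₁ (sources r)
    ; source<stale     = λ r → proj₁ (proj₂ (sources r))
    ; shared∈source    = λ r → proj₂ (proj₂ (sources r))
    }
    where
    stale-edge earlier : Subset V
    stale-edge = edges c (reflect j (suc t))
    earlier = prefixUnion (edges c) (reflectPerm j) (suc t)
    links : ∀ s → ∃ λ w → w ∈ E (visit c j (parent j s)) × w ∈ E (visit c j (suc s))
    links s = adjacent-edges-meet chain (reflect-parent-adjacent j s)
    sharing : Σ (Fin (suc b) → Fin V) λ f → Injective _≡_ _≡_ f × (∀ r → f r ∈ stale-edge ∩ earlier)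
    sharing = ≤∣p∣⇒injective (stale-edge ∩ earlier)
                (∣p─q∣<n∸b⇒b<∣p∩q∣ stale-edge earlier (uniform _) stale)
    shared∈ : ∀ r → proj₁ sharing r ∈ stale-edge × proj₁ sharing r ∈ earlier
    shared∈ r = x∈p∩q⁻ stale-edge earlier (proj₂ (proj₂ sharing) r)
    sources : ∀ r → ∃ λ i → i Fin.< suc t × proj₁ sharing r ∈ E (visit c j i)
    sources r = ∈-prefixUnion⁻ (edges c) (reflectPerm j) (suc t) (proj₂ (shared∈ r))

  codeSize : ℕ
  codeSize = d * ((n * d) ^ k * (K * n) ^ suc b)

  module _ {c j t} (C : Certificate c j t) where
    open Certificate C

    linkCode : Fin (suc k) → Fin (n * d)
    linkCode s = combine (position E uniform (link∈parent s)) (edgeIndex E degree≤ (link∈visit s))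

    sharedCode : Fin (suc b) → Fin (K * n)
    sharedCode r = combine (source r) (position E uniform (shared∈source r))

    -- The stale step t needs no link code: punchIn t skips it.
    code : Fin codeSize
    code = combine (edgeIndex E degree≤ v∈start)
                   (combine (funToFin (linkCode ∘ punchIn t)) (funToFin sharedCode))

  module Decode {c c′ j t} (C : Certificate c j t) (C′ : Certificate c′ j t)
                (same-code : code C ≡ code C′) where
    private
      module C  = Certificate C
      module C′ = Certificate C′
      links₁ links₂ : Fin ((n * d) ^ k)
      links₁ = funToFin (linkCode C ∘ punchIn t)
      links₂ = funToFin (linkCode C′ ∘ punchIn t)
      shared₁ shared₂ : Fin ((K * n) ^ suc b)
      shared₁ = funToFin (sharedCode C)
      shared₂ = funToFin (sharedCode C′)
      start₁ start₂ : Fin d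
      start₁ = edgeIndex E degree≤ C.v∈start
      start₂ = edgeIndex E degree≤ C′.v∈start
      split : start₁ ≡ start₂ × combine links₁ shared₁ ≡ combine links₂ shared₂
      split = combine-injective start₁ (combine links₁ shared₁) start₂ (combine links₂ shared₂) same-code

    start≡ : start₁ ≡ start₂
    start≡ = proj₁ split

    tables≡ : links₁ ≡ links₂ × shared₁ ≡ shared₂
    tables≡ = combine-injective links₁ shared₁ links₂ shared₂ (proj₂ split)

    linkCode≡ : ∀ s → s ≢ t → linkCode C s ≡ linkCode C′ s
    linkCode≡ s s≢t = subst (λ s → linkCode C s ≡ linkCode C′ s) (punchIn-punchOut t≢s)
                        (funToFin-injective (proj₁ tables≡) (punchOut t≢s))
      where
      t≢s : t ≢ s
      t≢s = s≢t ∘ sym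

    sharedCode≡ : ∀ r → sharedCode C r ≡ sharedCode C′ r
    sharedCode≡ = funToFin-injective (proj₂ tables≡)

    visit≡ : ∀ i → visit c j i ≡ visit c′ j i
    visit≡ = WF.All.wfRec <-wellFounded _ (λ i → visit c j i ≡ visit c′ j i) recover
      where
      recover : ∀ i → (∀ {i′} → i′ Fin.< i → visit c j i′ ≡ visit c′ j i′) → visit c j i ≡ visit c′ j i
      recover zero _ = edgeIndex-injective E degree≤ refl C.v∈start C′.v∈start start≡
      recover (suc s) earlier with s Fin.≟ t
      ... | no s≢t with combine-injective (position E uniform (C.link∈parent s)) (edgeIndex E degree≤ (C.link∈visit s))
                                          (position E uniform (C′.link∈parent s)) (edgeIndex E degree≤ (C′.link∈visit s))
                                          (linkCode≡ s s≢t)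
      ...   | position≡ , index≡ = edgeIndex-injective E degree≤ link≡ (C.link∈visit s) (C′.link∈visit s) index≡
        where
        link≡ : C.link s ≡ C′.link s
        link≡ = position-injective E uniform (earlier (parent< j s)) (C.link∈parent s) (C′.link∈parent s) position≡
      recover (suc s) earlier | yes refl =
        shared-vertices⇒same-edge E simple C.shared C.shared-injective C.shared∈stale shared∈stale′
        where
        shared≡ : ∀ r → C.shared r ≡ C′.shared r
        shared≡ r with combine-injective (C.source r) (position E uniform (C.shared∈source r))
                                         (C′.source r) (position E uniform (C′.shared∈source r)) (sharedCode≡ r)
        ... | source≡ , position≡ = position-injective E uniform
                (trans (earlier (C.source<stale r)) (cong (visit c′ j) source≡))
                (C.shared∈source r) (C′.shared∈source r) position≡
        shared∈stale′ : ∀ r → C.shared r ∈ E (visit c′ j (suc s))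
        shared∈stale′ r = subst (_∈ E (visit c′ j (suc s))) (sym (shared≡ r)) (C′.shared∈stale r)

    c≡c′ : c ≡ c′
    c≡c′ = begin
      c                    ≡⟨ tabulate∘lookup c ⟨
      tabulate (lookup c)  ≡⟨ tabulate-cong lookup≡ ⟩
      tabulate (lookup c′) ≡⟨ tabulate∘lookup c′ ⟩
      c′                   ∎
      where
      open ≡-Reasoning
      lookup≡ : ∀ x → lookup c x ≡ lookup c′ x
      lookup≡ x = subst (λ y → lookup c y ≡ lookup c′ y) (reflect-involutive j x) (visit≡ (reflect j x))

  encode : ∀ {c} → Certified c → Fin (K * (suc k * codeSize))
  encode (j , t , C) = combine j (combine t (code C))

  encode-injective : ∀ {c c′} (X : Certified c) (X′ : Certified c′) → encode X ≡ encode X′ → c ≡ c′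
  encode-injective (j , t , C) (j′ , t′ , C′) eq with combine-injective j _ j′ _ eq
  ... | refl , eq′ with combine-injective t _ t′ _ eq′
  ...   | refl , eq″ = Decode.c≡c′ C C′ eq″

  length≤ : ∀ {cs} → Unique cs → All NonDisjointThrough-v cs → length cs ≤ K * (suc k * codeSize)
  length≤ = length≤-of-injective-code (λ {c} → encode ∘ certify {c})
              (λ {c} {c′} p p′ → encode-injective (certify {c} p) (certify {c′} p′))

^-distribʳ-* : ∀ m n o → (m * n) ^ o ≡ m ^ o * n ^ o
^-distribʳ-* m n zero = refl
^-distribʳ-* m n (suc o) = begin
  m * n * (m * n) ^ o          ≡⟨ cong (m * n *_) (^-distribʳ-* m n o) ⟩
  m * n * (m ^ o * n ^ o)      ≡⟨ solve 4 (λ m n x y → m :* n :* (x :* y) := m :* x :* (n :* y)) refl m n (m ^ o) (n ^ o) ⟩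
  m * m ^ o * (n * n ^ o)      ∎
  where
  open ≡-Reasoning
  open +-*-Solver

m^[1+n]≤m^[2+n] : ∀ m n → m ^ suc n ≤ m ^ suc (suc n)
m^[1+n]≤m^[2+n] zero    n = z≤n
m^[1+n]≤m^[2+n] (suc m) n = m≤m+n _ _

chain-count≤ : ∀ k n d b →
  (2 + k) * (suc k * (d * ((n * d) ^ k * ((2 + k) * n) ^ suc b)))
    ≤ d ^ suc k * n ^ (2 + k + b) * (2 + k) ^ (3 + b)
chain-count≤ k n d b = begin
  K * (suc k * (d * ((n * d) ^ k * (K * n) ^ suc b)))
    ≡⟨ cong₂ (λ x y → K * (suc k * (d * (x * y)))) (^-distribʳ-* n d k) (^-distribʳ-* K n (suc b)) ⟩
  K * (suc k * (d * ((n ^ k * d ^ k) * (K ^ suc b * n ^ suc b))))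
    ≡⟨ solve 7 (λ K k′ d nᵏ dᵏ Kᵇ nᵇ → K :* (k′ :* (d :* ((nᵏ :* dᵏ) :* (Kᵇ :* nᵇ))))
                                      := d :* dᵏ :* (nᵏ :* nᵇ) :* (K :* k′ :* Kᵇ))
             refl K (suc k) d (n ^ k) (d ^ k) (K ^ suc b) (n ^ suc b) ⟩
  d ^ suc k * (n ^ k * n ^ suc b) * (K * suc k * K ^ suc b)
    ≡⟨ cong (λ x → d ^ suc k * x * (K * suc k * K ^ suc b)) (^-distribˡ-+-* n k (suc b)) ⟨
  d ^ suc k * n ^ (k + suc b) * (K * suc k * K ^ suc b)
    ≤⟨ *-mono-≤ (*-monoʳ-≤ (d ^ suc k) n-exponent) (*-monoˡ-≤ (K ^ suc b) (*-monoʳ-≤ K (n≤1+n (suc k)))) ⟩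
  d ^ suc k * n ^ (2 + k + b) * (K * K * K ^ suc b)
    ≡⟨ cong (d ^ suc k * n ^ (2 + k + b) *_) (*-assoc K K (K ^ suc b)) ⟩
  d ^ suc k * n ^ (2 + k + b) * K ^ (3 + b) ∎
  where
  open ≤-Reasoning
  open +-*-Solver
  K : ℕ
  K = 2 + k
  n-exponent : n ^ (k + suc b) ≤ n ^ (2 + k + b)
  n-exponent = subst (λ e → n ^ e ≤ n ^ (2 + k + b)) (sym (+-suc k b)) (m^[1+n]≤m^[2+n] n (k + b))

monomial : ℕ → List ℕ
monomial r = List.replicate r 0 List.++ 1 ∷ []

evalPoly-monomial : ∀ r z → evalPoly (monomial r) z ≡ z ^ r
evalPoly-monomial zero    z = cong suc (*-zeroʳ z)
evalPoly-monomial (suc r) z = cong (z *_) (evalPoly-monomial r z)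

proposition16 : (b : ℕ) → 1 ≤ b → ∃ λ (u : List ℕ) →
    (V m : ℕ) (E : Fin m → Subset V) (n d : ℕ) →
    IsEdgeFamily E → Uniform n E → Simple b E → MaxDegree d E →
    (v : Fin V) (k : ℕ) → 3 ≤ k →
    (cs : List (Vec (Fin m) k)) → Unique cs →
    All (λ c → IsChain (λ i → E (lookup c i)) × BelongsTo v (λ i → E (lookup c i))
               × ¬ BDisjoint n b (λ i → E (lookup c i))) cs →
    length cs ≤ d ^ (k ∸ 1) * n ^ (k + b) * evalPoly u k
proposition16 b _ = monomial (3 + b) ,
  λ { V m E n d _ uniform simple (degree≤ , _) v (suc (suc k)) (s≤s (s≤s _)) cs unique chains → begin
    length cs
      ≤⟨ NonDisjointChains.length≤ E uniform simple degree≤ v k unique chains ⟩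
    (2 + k) * (suc k * (d * ((n * d) ^ k * ((2 + k) * n) ^ suc b)))
      ≤⟨ chain-count≤ k n d b ⟩
    d ^ suc k * n ^ (2 + k + b) * (2 + k) ^ (3 + b)
      ≡⟨ cong (d ^ suc k * n ^ (2 + k + b) *_) (evalPoly-monomial (3 + b) (2 + k)) ⟨
    d ^ suc k * n ^ (2 + k + b) * evalPoly (monomial (3 + b)) (2 + k) ∎ }
  where open ≤-Reasoning
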